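{- For all integers $m\geq 1$ and $n\geq 1$, every real $x$ and every real $y\neq 0$, \[ m^{n-1}\sum_{k=0}^{m-1}w_{n-1}\!\left(x+\frac{k}{m};y\right)=\frac{1}{ny}\sum_{k=1}^{n}\binom{n}{k}m^{k}\,B_{n-k}(mx)\,w_{k}(y). \]
   Context: The Bernoulli polynomials are defined by $\sum_{n\ge0}B_n(x)\frac{t^n}{n!}=\frac{te^{xt}}{e^t-1}$. The geometric polynomials $w_n(y)$ are defined by $\frac{1}{1-y(e^t-1)}=\sum_{n\ge0}w_n(y)\frac{t^n}{n!}$, and the two-variable geometric polynomials $w_n(x;y)$ by $\frac{e^{xt}}{1-y(e^t-1)}=\sum_{n\ge 0}w_n(x;y)\frac{t^n}{n!}$; equivalently $w_n(x;y)=\sum_{k=0}^n\binom nk w_k(y)x^{n-k}$.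
   Formalization: The variables x and y range over the rationals instead of the reals. -}

module Defs where

open import Data.Nat as ℕ using (ℕ; zero; suc; _≡ᵇ_)
open import Data.Nat.Combinatorics using (_C_)
open import Data.Integer using (+_)
open import Data.Rational using (ℚ; 0ℚ; 1ℚ; _+_; _*_; _-_; _/_; 1/_; ≢-nonZero)
open import Data.Rational.Properties using (_≟_)
open import Data.Bool using (if_then_else_)
open import Relation.Nullary using (yes; no)

ℕ→ℚ : ℕ → ℚ
ℕ→ℚ n = + n / 1

_^_ : ℚ → ℕ → ℚ
q ^ zero = 1ℚ
q ^ suc n = q * (q ^ n)

binom : ℕ → ℕ → ℚ
binom n k = ℕ→ℚ (n C k)

sumBelow : ℕ → (ℕ → ℚ) → ℚ
sumBelow zero f = 0ℚ
sumBelow (suc n) f = sumBelow n f + f n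

-- Σ_{k=a}^{b} f k  (empty when b < a)
sumFromTo : ℕ → ℕ → (ℕ → ℚ) → ℚ
sumFromTo a b f = sumBelow (suc b ℕ.∸ a) (λ i → f (a ℕ.+ i))

-- multiplicative inverse (only ever applied to nonzero arguments;
-- the value at 0 is an irrelevant convention)
recip : ℚ → ℚ
recip q with q ≟ 0ℚ
... | yes _ = 0ℚ
... | no q≢0 = 1/_ q {{≢-nonZero q≢0}}

upd : ℕ → ℚ → (ℕ → ℚ) → ℕ → ℚ
upd n v f k = if k ≡ᵇ n then v else f k

-- Bernoulli polynomials, from t e^{xt}/(e^t-1) = Σ B_n(x) t^n/n!.
-- Comparing coefficients of t^{n+1}/(n+1)! in t e^{xt} = (e^t - 1) Σ B_k(x) t^k/k!:
--   (n+1) x^n = Σ_{k=0}^{n} C(n+1,k) B_k(x),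
-- i.e.  B_n(x) = x^n - (1/(n+1)) Σ_{k<n} C(n+1,k) B_k(x).
-- bernTable n x k = B_k(x) for all k < n.
bernTable : ℕ → ℚ → ℕ → ℚ
bernTable zero x = λ _ → 0ℚ
bernTable (suc n) x =
  upd n (x ^ n - recip (ℕ→ℚ (suc n)) * sumBelow n (λ k → binom (suc n) k * bernTable n x k))
        (bernTable n x)

B : ℕ → ℚ → ℚ
B n x = bernTable (suc n) x n

-- Geometric polynomials, from 1/(1 - y(e^t - 1)) = Σ w_n(y) t^n/n!.
-- With f = Σ w_n t^n/n!, f = 1 + y (e^t - 1) f, so comparing coefficients
--   w_0(y) = 1,   w_n(y) = y Σ_{k<n} C(n,k) w_k(y)  (n ≥ 1).
-- geomTable n y k = w_k(y) for all k < n.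
geomTable : ℕ → ℚ → ℕ → ℚ
geomTable zero y = λ _ → 0ℚ
geomTable (suc zero) y = upd 0 1ℚ (λ _ → 0ℚ)
geomTable (suc (suc n)) y =
  upd (suc n) (y * sumBelow (suc n) (λ k → binom (suc n) k * geomTable (suc n) y k))
      (geomTable (suc n) y)

w : ℕ → ℚ → ℚ
w n y = geomTable (suc n) y n

w₂ : ℕ → ℚ → ℚ → ℚ
w₂ n x y = sumFromTo 0 n (λ k → binom n k * w k y * (x ^ (n ℕ.∸ k)))

{-# OPTIONS --safe #-}
-- Read a sequence f as the exponential generating function Σ f n tⁿ/n!.  The
-- defining recurrences then say (e^t − 1) B(z; t) = t e^{zt} and
-- W(t) − 1 = y (e^t − 1) W(t) for W(t) = Σ w_n(y) tⁿ/n!.  Put z = m x and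
-- V(t) = W(m t).  The right-hand sum, times n y, is the coefficient of tⁿ/n! in
-- (V(t) − 1) B(z; t) = y (e^{mt} − 1) V(t) B(z; t), and because
-- e^{mt} − 1 = (e^t − 1) Σ_{j<m} e^{jt} this series is y t Σ_{j<m} V(t) e^{(z+j)t}.
-- Its coefficient is n y Σ_{j<m} m^{n−1} w_{n−1}(x + j/m; y), as
-- V(t) e^{(z+j)t} = W(m t) e^{(x + j/m) m t}.
module Submission where

open import Defs
open import Data.Nat as ℕ using (ℕ; zero; suc; _≤_; _<_; _∸_; s≤s)
import Data.Nat.Properties as ℕ
open import Data.Nat.Combinatorics using (_C_; nCk+nC[k+1]≡[n+1]C[k+1]; k>n⇒nCk≡0; nCk≡nC[n∸k]; nC1≡n)
import Data.Nat.Coprimality as Coprime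
import Data.Integer as ℤ
import Data.Integer.Properties as ℤ
open import Data.Rational using (ℚ; 0ℚ; 1ℚ; _+_; _*_; _-_; _/_; mkℚ; ↥_; ≢-nonZero)
open import Data.Rational.Properties
  using (_≟_; ↥p/↧p≡p; +-comm; +-assoc; +-identityˡ; +-identityʳ; *-comm; *-assoc;
         *-identityˡ; *-identityʳ; *-zeroˡ; *-zeroʳ; *-distribˡ-+; *-distribʳ-+; *-inverseˡ; +-0-commutativeMonoid)
open import Data.Rational.Solver using (module +-*-Solver)
open import Algebra.Bundles using (CommutativeMonoid)
open import Algebra.Properties.CommutativeSemigroup
  (CommutativeMonoid.commutativeSemigroup +-0-commutativeMonoid) using () renaming (interchange to +-interchange)
open import Data.Bool using (true; false)
open import Function using (_∘_; const)
open import Relation.Binary.PropositionalEquality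
open import Relation.Nullary using (yes; no; contradiction)
import Relation.Binary.Reasoning.Setoid as SetoidReasoning

open +-*-Solver

-- ℕ→ℚ n = + n / 1 normalises through a gcd and is stuck for a variable n;
-- fromℕ n is the same number already in normal form, on which _+_ computes.
fromℕ : ℕ → ℚ
fromℕ n = mkℚ (ℤ.+ n) 0 (Coprime.sym (Coprime.1-coprimeTo n))

ℕ→ℚ≡fromℕ : ∀ n → ℕ→ℚ n ≡ fromℕ n
ℕ→ℚ≡fromℕ n = ↥p/↧p≡p (fromℕ n)

ℕ→ℚ-suc : ∀ n → ℕ→ℚ (suc n) ≡ 1ℚ + ℕ→ℚ n
ℕ→ℚ-suc n = begin
  ℕ→ℚ (suc n)           ≡⟨ cong (λ i → (ℤ.+ 1 ℤ.+ i) / 1) (sym (ℤ.*-identityʳ (ℤ.+ n))) ⟩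
  1ℚ + fromℕ n            ≡⟨ cong (1ℚ +_) (sym (ℕ→ℚ≡fromℕ n)) ⟩
  1ℚ + ℕ→ℚ n              ∎
  where open ≡-Reasoning

ℕ→ℚ-+ : ∀ m n → ℕ→ℚ (m ℕ.+ n) ≡ ℕ→ℚ m + ℕ→ℚ n
ℕ→ℚ-+ zero    n = sym (+-identityˡ (ℕ→ℚ n))
ℕ→ℚ-+ (suc m) n = begin
  ℕ→ℚ (suc (m ℕ.+ n))   ≡⟨ ℕ→ℚ-suc (m ℕ.+ n) ⟩
  1ℚ + ℕ→ℚ (m ℕ.+ n)    ≡⟨ cong (1ℚ +_) (ℕ→ℚ-+ m n) ⟩
  1ℚ + (ℕ→ℚ m + ℕ→ℚ n)  ≡⟨ sym (+-assoc 1ℚ (ℕ→ℚ m) (ℕ→ℚ n)) ⟩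
  1ℚ + ℕ→ℚ m + ℕ→ℚ n    ≡⟨ cong (_+ ℕ→ℚ n) (sym (ℕ→ℚ-suc m)) ⟩
  ℕ→ℚ (suc m) + ℕ→ℚ n   ∎
  where open ≡-Reasoning

ℕ→ℚ-suc≢0 : ∀ n → ℕ→ℚ (suc n) ≢ 0ℚ
ℕ→ℚ-suc≢0 n eq with cong ↥_ (trans (sym (ℕ→ℚ≡fromℕ (suc n))) eq)
... | ()

ℕ→ℚ-suc-* : ∀ n q → ℕ→ℚ (suc n) * q ≡ q + ℕ→ℚ n * q
ℕ→ℚ-suc-* n q = begin
  ℕ→ℚ (suc n) * q       ≡⟨ cong (_* q) (ℕ→ℚ-suc n) ⟩
  (1ℚ + ℕ→ℚ n) * q      ≡⟨ *-distribʳ-+ q 1ℚ (ℕ→ℚ n) ⟩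
  1ℚ * q + ℕ→ℚ n * q    ≡⟨ cong (_+ ℕ→ℚ n * q) (*-identityˡ q) ⟩
  q + ℕ→ℚ n * q         ∎
  where open ≡-Reasoning

recip-inverseˡ : ∀ {q} → q ≢ 0ℚ → recip q * q ≡ 1ℚ
recip-inverseˡ {q} q≢0 with q ≟ 0ℚ
... | yes q≡0 = contradiction q≡0 q≢0
... | no  q≢0 = *-inverseˡ q {{≢-nonZero q≢0}}

recip-*-cancelˡ : ∀ {q} → q ≢ 0ℚ → ∀ r → recip q * (q * r) ≡ r
recip-*-cancelˡ {q} q≢0 r = begin
  recip q * (q * r)  ≡⟨ sym (*-assoc (recip q) q r) ⟩
  recip q * q * r    ≡⟨ cong (_* r) (recip-inverseˡ q≢0) ⟩
  1ℚ * r             ≡⟨ *-identityˡ r ⟩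
  r                  ∎
  where open ≡-Reasoning

*-≢0 : ∀ {p q} → p ≢ 0ℚ → q ≢ 0ℚ → p * q ≢ 0ℚ
*-≢0 {p} {q} p≢0 q≢0 pq≡0 = q≢0 (begin
  q                  ≡⟨ sym (recip-*-cancelˡ p≢0 q) ⟩
  recip p * (p * q)  ≡⟨ cong (recip p *_) pq≡0 ⟩
  recip p * 0ℚ       ≡⟨ *-zeroʳ (recip p) ⟩
  0ℚ                 ∎)
  where open ≡-Reasoning

^-zeroˡ : ∀ n → 1ℚ ^ n ≡ 1ℚ
^-zeroˡ zero    = refl
^-zeroˡ (suc n) = trans (cong (1ℚ *_) (^-zeroˡ n)) (*-identityˡ 1ℚ)

^-distribʳ-* : ∀ a b n → (a * b) ^ n ≡ a ^ n * b ^ n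
^-distribʳ-* a b zero    = refl
^-distribʳ-* a b (suc n) = begin
  a * b * (a * b) ^ n      ≡⟨ cong (a * b *_) (^-distribʳ-* a b n) ⟩
  a * b * (a ^ n * b ^ n)  ≡⟨ solve 4 (λ a b c d → a :* b :* (c :* d) := a :* c :* (b :* d)) refl a b (a ^ n) (b ^ n) ⟩
  a ^ suc n * b ^ suc n    ∎
  where open ≡-Reasoning

binom-pascal : ∀ n k → binom (suc n) (suc k) ≡ binom n k + binom n (suc k)
binom-pascal n k = trans (cong ℕ→ℚ (sym (nCk+nC[k+1]≡[n+1]C[k+1] n k))) (ℕ→ℚ-+ (n C k) (n C suc k))

binom[n,1+n]≡0 : ∀ n → binom n (suc n) ≡ 0ℚ
binom[n,1+n]≡0 n = cong ℕ→ℚ (k>n⇒nCk≡0 (ℕ.n<1+n n))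

binom[1+n,n]≡1+n : ∀ n → binom (suc n) n ≡ ℕ→ℚ (suc n)
binom[1+n,n]≡1+n n = cong ℕ→ℚ (begin
  suc n C n              ≡⟨ nCk≡nC[n∸k] (ℕ.n≤1+n n) ⟩
  suc n C (suc n ∸ n)    ≡⟨ cong (suc n C_) (ℕ.m+n∸n≡m 1 n) ⟩
  suc n C 1              ≡⟨ nC1≡n (suc n) ⟩
  suc n                  ∎)
  where open ≡-Reasoning

upd-same : ∀ n v f → upd n v f n ≡ v
upd-same n v f with n ℕ.≡ᵇ n | ℕ.≡⇒≡ᵇ n n refl
... | true | _ = refl

upd-other : ∀ {n k} v f → k ≢ n → upd n v f k ≡ f k
upd-other {n} {k} v f k≢n with k ℕ.≡ᵇ n | ℕ.≡ᵇ⇒≡ k n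
... | false | _   = refl
... | true  | k≡n = contradiction (k≡n _) k≢n

upd-table : ∀ {n v} {f g : ℕ → ℚ} → g n ≡ v → (∀ {k} → k < n → f k ≡ g k) →
            ∀ {k} → k < suc n → upd n v f k ≡ g k
upd-table {n} {v} {f} gn≡v f≡g {k} k<1+n with k ℕ.≟ n
... | yes refl = trans (upd-same n v f) (sym gn≡v)
... | no  k≢n  = trans (upd-other v f k≢n) (f≡g (ℕ.≤∧≢⇒< (ℕ.≤-pred k<1+n) k≢n))

sumBelow-cong-< : ∀ n {f g : ℕ → ℚ} → (∀ {k} → k < n → f k ≡ g k) → sumBelow n f ≡ sumBelow n g
sumBelow-cong-< zero    f≡g = refl
sumBelow-cong-< (suc n) f≡g = cong₂ _+_ (sumBelow-cong-< n (f≡g ∘ ℕ.m<n⇒m<1+n)) (f≡g (ℕ.n<1+n n))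

sumBelow-cong : ∀ n {f g : ℕ → ℚ} → f ≗ g → sumBelow n f ≡ sumBelow n g
sumBelow-cong n f≗g = sumBelow-cong-< n (λ {k} _ → f≗g k)

sumBelow-suc-first : ∀ n f → sumBelow (suc n) f ≡ f 0 + sumBelow n (f ∘ suc)
sumBelow-suc-first zero    f = trans (+-identityˡ (f 0)) (sym (+-identityʳ (f 0)))
sumBelow-suc-first (suc n) f = trans (cong (_+ f (suc n)) (sumBelow-suc-first n f)) (+-assoc (f 0) _ _)

sumBelow-+ : ∀ n f g → sumBelow n (λ k → f k + g k) ≡ sumBelow n f + sumBelow n g
sumBelow-+ zero    f g = refl
sumBelow-+ (suc n) f g = begin
  sumBelow n (λ k → f k + g k) + (f n + g n)  ≡⟨ cong (_+ (f n + g n)) (sumBelow-+ n f g) ⟩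
  sumBelow n f + sumBelow n g + (f n + g n)   ≡⟨ +-interchange (sumBelow n f) _ _ _ ⟩
  sumBelow n f + f n + (sumBelow n g + g n)   ∎
  where open ≡-Reasoning

sumBelow-*ˡ : ∀ n c f → sumBelow n (λ k → c * f k) ≡ c * sumBelow n f
sumBelow-*ˡ zero    c f = sym (*-zeroʳ c)
sumBelow-*ˡ (suc n) c f = trans (cong (_+ c * f n) (sumBelow-*ˡ n c f)) (sym (*-distribˡ-+ c (sumBelow n f) (f n)))

sumBelow-telescope : ∀ n (F : ℕ → ℚ) → sumBelow n (λ j → F (suc j) - F j) ≡ F n - F 0
sumBelow-telescope zero    F = solve 1 (λ a → con 0ℚ := a :- a) refl (F 0)
sumBelow-telescope (suc n) F = begin
  sumBelow n (λ j → F (suc j) - F j) + (F (suc n) - F n)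
    ≡⟨ cong (_+ (F (suc n) - F n)) (sumBelow-telescope n F) ⟩
  F n - F 0 + (F (suc n) - F n)
    ≡⟨ solve 3 (λ a b c → b :- a :+ (c :- b) := c :- a) refl (F 0) (F n) (F (suc n)) ⟩
  F (suc n) - F 0
    ∎
  where open ≡-Reasoning

Seq : Set
Seq = ℕ → ℚ

module ≗-Reasoning = SetoidReasoning (ℕ →-setoid ℚ)

-- d/dt on generating functions
shift : Seq → Seq
shift f n = f (suc n)

infixl 6 _⊕_
infixl 7 _⋆_
infixr 8 _·_

_⊕_ : Seq → Seq → Seq
(f ⊕ g) n = f n + g n

_·_ : ℚ → Seq → Seq
(c · f) n = c * f n

-- The product of generating functions, defined through the Leibniz rule
-- (f g)′ = f′ g + f g′; ⋆-binomialSum recovers the binomial convolution.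
_⋆_ : Seq → Seq → Seq
(f ⋆ g) zero    = f 0 * g 0
(f ⋆ g) (suc n) = (shift f ⋆ g) n + (f ⋆ shift g) n

⋆-cong : ∀ {f f′ g g′} → f ≗ f′ → g ≗ g′ → f ⋆ g ≗ f′ ⋆ g′
⋆-cong f≗f′ g≗g′ zero    = cong₂ _*_ (f≗f′ 0) (g≗g′ 0)
⋆-cong f≗f′ g≗g′ (suc n) = cong₂ _+_ (⋆-cong (f≗f′ ∘ suc) g≗g′ n) (⋆-cong f≗f′ (g≗g′ ∘ suc) n)

⋆-congˡ : ∀ f {g g′} → g ≗ g′ → f ⋆ g ≗ f ⋆ g′
⋆-congˡ f = ⋆-cong {f} (λ _ → refl)

⋆-congʳ : ∀ g {f f′} → f ≗ f′ → f ⋆ g ≗ f′ ⋆ g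
⋆-congʳ g f≗f′ = ⋆-cong f≗f′ (λ _ → refl)

⋆-comm : ∀ f g → f ⋆ g ≗ g ⋆ f
⋆-comm f g zero    = *-comm (f 0) (g 0)
⋆-comm f g (suc n) = trans (cong₂ _+_ (⋆-comm (shift f) g n) (⋆-comm f (shift g) n))
                           (+-comm ((g ⋆ shift f) n) ((shift g ⋆ f) n))

⋆-distribʳ-⊕ : ∀ h f g → (f ⊕ g) ⋆ h ≗ f ⋆ h ⊕ g ⋆ h
⋆-distribʳ-⊕ h f g zero    = *-distribʳ-+ (h 0) (f 0) (g 0)
⋆-distribʳ-⊕ h f g (suc n) = begin
  ((shift f ⊕ shift g) ⋆ h) n + ((f ⊕ g) ⋆ shift h) n
    ≡⟨ cong₂ _+_ (⋆-distribʳ-⊕ h (shift f) (shift g) n) (⋆-distribʳ-⊕ (shift h) f g n) ⟩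
  (shift f ⋆ h) n + (shift g ⋆ h) n + ((f ⋆ shift h) n + (g ⋆ shift h) n)
    ≡⟨ +-interchange ((shift f ⋆ h) n) _ _ _ ⟩
  (f ⋆ h) (suc n) + (g ⋆ h) (suc n)
    ∎
  where open ≡-Reasoning

⋆-distribˡ-⊕ : ∀ f g h → f ⋆ (g ⊕ h) ≗ f ⋆ g ⊕ f ⋆ h
⋆-distribˡ-⊕ f g h n = begin
  (f ⋆ (g ⊕ h)) n            ≡⟨ ⋆-comm f (g ⊕ h) n ⟩
  ((g ⊕ h) ⋆ f) n            ≡⟨ ⋆-distribʳ-⊕ f g h n ⟩
  (g ⋆ f) n + (h ⋆ f) n      ≡⟨ cong₂ _+_ (⋆-comm g f n) (⋆-comm h f n) ⟩
  (f ⋆ g) n + (f ⋆ h) n      ∎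
  where open ≡-Reasoning

·-⋆-assoc : ∀ c f g → (c · f) ⋆ g ≗ c · (f ⋆ g)
·-⋆-assoc c f g zero    = *-assoc c (f 0) (g 0)
·-⋆-assoc c f g (suc n) = trans (cong₂ _+_ (·-⋆-assoc c (shift f) g n) (·-⋆-assoc c f (shift g) n))
                                (sym (*-distribˡ-+ c _ _))

⋆-·-comm : ∀ c f g → f ⋆ (c · g) ≗ c · (f ⋆ g)
⋆-·-comm c f g n = begin
  (f ⋆ (c · g)) n  ≡⟨ ⋆-comm f (c · g) n ⟩
  ((c · g) ⋆ f) n  ≡⟨ ·-⋆-assoc c g f n ⟩
  c * (g ⋆ f) n    ≡⟨ cong (c *_) (⋆-comm g f n) ⟩
  c * (f ⋆ g) n    ∎
  where open ≡-Reasoning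

·-congˡ : ∀ c {f g} → f ≗ g → c · f ≗ c · g
·-congˡ c f≗g n = cong (c *_) (f≗g n)

⋆-zeroʳ : ∀ f → f ⋆ const 0ℚ ≗ const 0ℚ
⋆-zeroʳ f zero    = *-zeroʳ (f 0)
⋆-zeroʳ f (suc n) = cong₂ _+_ (⋆-zeroʳ (shift f) n) (⋆-zeroʳ f n)

⋆-assoc : ∀ f g h → (f ⋆ g) ⋆ h ≗ f ⋆ (g ⋆ h)
⋆-assoc f g h zero    = *-assoc (f 0) (g 0) (h 0)
⋆-assoc f g h (suc n) = begin
  ((shift f ⋆ g ⊕ f ⋆ shift g) ⋆ h) n + ((f ⋆ g) ⋆ shift h) n
    ≡⟨ cong (_+ ((f ⋆ g) ⋆ shift h) n) (⋆-distribʳ-⊕ h (shift f ⋆ g) (f ⋆ shift g) n) ⟩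
  ((shift f ⋆ g) ⋆ h) n + ((f ⋆ shift g) ⋆ h) n + ((f ⋆ g) ⋆ shift h) n
    ≡⟨ cong₂ _+_ (cong₂ _+_ (⋆-assoc (shift f) g h n) (⋆-assoc f (shift g) h n)) (⋆-assoc f g (shift h) n) ⟩
  (shift f ⋆ (g ⋆ h)) n + (f ⋆ (shift g ⋆ h)) n + (f ⋆ (g ⋆ shift h)) n
    ≡⟨ +-assoc ((shift f ⋆ (g ⋆ h)) n) _ _ ⟩
  (shift f ⋆ (g ⋆ h)) n + ((f ⋆ (shift g ⋆ h)) n + (f ⋆ (g ⋆ shift h)) n)
    ≡⟨ cong ((shift f ⋆ (g ⋆ h)) n +_) (sym (⋆-distribˡ-⊕ f (shift g ⋆ h) (g ⋆ shift h) n)) ⟩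
  (shift f ⋆ (g ⋆ h)) n + (f ⋆ shift (g ⋆ h)) n
    ∎
  where open ≡-Reasoning

⋆-distribˡ-sumBelow : ∀ m f (h : ℕ → Seq) →
                      f ⋆ (λ k → sumBelow m (λ j → h j k)) ≗ (λ n → sumBelow m (λ j → (f ⋆ h j) n))
⋆-distribˡ-sumBelow zero    f h = ⋆-zeroʳ f
⋆-distribˡ-sumBelow (suc m) f h n =
  trans (⋆-distribˡ-⊕ f (λ k → sumBelow m (λ j → h j k)) (h m) n)
        (cong (_+ (f ⋆ h m) n) (⋆-distribˡ-sumBelow m f h n))

-- The generating functions e^{at}, f(ct), t f(t), e^t − 1, f(t) − f(0) and
-- Σ_{j<m} e^{jt}.
exp : ℚ → Seq
exp a n = a ^ n

dilate : ℚ → Seq → Seq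
dilate c f n = c ^ n * f n

mulT : Seq → Seq
mulT f zero    = 0ℚ
mulT f (suc n) = ℕ→ℚ (suc n) * f n

expm1 : Seq
expm1 zero    = 0ℚ
expm1 (suc n) = 1ℚ

dropConst : Seq → Seq
dropConst f zero    = 0ℚ
dropConst f (suc n) = f (suc n)

powerSums : ℕ → Seq
powerSums m n = sumBelow m (λ j → ℕ→ℚ j ^ n)

exp-⋆-exp : ∀ a b → exp a ⋆ exp b ≗ exp (a + b)
exp-⋆-exp a b zero    = *-identityˡ 1ℚ
exp-⋆-exp a b (suc n) = begin
  (a · exp a ⋆ exp b) n + (exp a ⋆ b · exp b) n
    ≡⟨ cong₂ _+_ (·-⋆-assoc a (exp a) (exp b) n) (⋆-·-comm b (exp a) (exp b) n) ⟩
  a * (exp a ⋆ exp b) n + b * (exp a ⋆ exp b) n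
    ≡⟨ sym (*-distribʳ-+ _ a b) ⟩
  (a + b) * (exp a ⋆ exp b) n
    ≡⟨ cong ((a + b) *_) (exp-⋆-exp a b n) ⟩
  (a + b) * (a + b) ^ n
    ∎
  where open ≡-Reasoning

dilate-exp : ∀ c a → dilate c (exp a) ≗ exp (c * a)
dilate-exp c a n = sym (^-distribʳ-* c a n)

dilate-cong : ∀ c {f g} → f ≗ g → dilate c f ≗ dilate c g
dilate-cong c f≗g n = cong (c ^ n *_) (f≗g n)

dilate-dropConst : ∀ c f → dilate c (dropConst f) ≗ dropConst (dilate c f)
dilate-dropConst c f zero    = refl
dilate-dropConst c f (suc n) = refl

dilate-· : ∀ c a f → dilate c (a · f) ≗ a · dilate c f
dilate-· c a f n = solve 3 (λ c a x → c :* (a :* x) := a :* (c :* x)) refl (c ^ n) a (f n)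

dilate-⋆ : ∀ c f g → dilate c (f ⋆ g) ≗ dilate c f ⋆ dilate c g
dilate-⋆ c f g zero    = trans (*-identityˡ (f 0 * g 0)) (sym (cong₂ _*_ (*-identityˡ (f 0)) (*-identityˡ (g 0))))
dilate-⋆ c f g (suc n) = begin
  c * c ^ n * ((shift f ⋆ g) n + (f ⋆ shift g) n)
    ≡⟨ solve 4 (λ c d a b → c :* d :* (a :+ b) := c :* (d :* a) :+ c :* (d :* b)) refl c (c ^ n) _ _ ⟩
  c * dilate c (shift f ⋆ g) n + c * dilate c (f ⋆ shift g) n
    ≡⟨ cong₂ _+_ (cong (c *_) (dilate-⋆ c (shift f) g n)) (cong (c *_) (dilate-⋆ c f (shift g) n)) ⟩
  c * (dilate c (shift f) ⋆ dilate c g) n + c * (dilate c f ⋆ dilate c (shift g)) n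
    ≡⟨ sym (cong₂ _+_ (·-⋆-assoc c (dilate c (shift f)) (dilate c g) n)
                      (⋆-·-comm c (dilate c f) (dilate c (shift g)) n)) ⟩
  (c · dilate c (shift f) ⋆ dilate c g) n + (dilate c f ⋆ c · dilate c (shift g)) n
    ≡⟨ cong₂ _+_ (⋆-congʳ (dilate c g) (λ k → sym (*-assoc c (c ^ k) (f (suc k)))) n)
                 (⋆-congˡ (dilate c f) (λ k → sym (*-assoc c (c ^ k) (g (suc k)))) n) ⟩
  (dilate c f ⋆ dilate c g) (suc n)
    ∎
  where open ≡-Reasoning

shift-mulT : ∀ f → shift (mulT f) ≗ f ⊕ mulT (shift f)
shift-mulT f zero    = trans (*-identityˡ (f 0)) (sym (+-identityʳ (f 0)))
shift-mulT f (suc n) = ℕ→ℚ-suc-* (suc n) (f (suc n))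

mulT-cong : ∀ {f g} → f ≗ g → mulT f ≗ mulT g
mulT-cong f≗g zero    = refl
mulT-cong f≗g (suc n) = cong (ℕ→ℚ (suc n) *_) (f≗g n)

mulT-⊕ : ∀ f g → mulT f ⊕ mulT g ≗ mulT (f ⊕ g)
mulT-⊕ f g zero    = refl
mulT-⊕ f g (suc n) = sym (*-distribˡ-+ (ℕ→ℚ (suc n)) (f n) (g n))

mulT-shift : ∀ f n → mulT (shift f) n ≡ ℕ→ℚ n * f n
mulT-shift f zero    = sym (*-zeroˡ (f 0))
mulT-shift f (suc n) = refl

mulT-⋆ : ∀ f g → mulT f ⋆ g ≗ mulT (f ⋆ g)
mulT-⋆ f g zero    = *-zeroˡ (g 0)
mulT-⋆ f g (suc n) = begin
  (shift (mulT f) ⋆ g) n + (mulT f ⋆ shift g) n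
    ≡⟨ cong (_+ (mulT f ⋆ shift g) n)
            (trans (⋆-congʳ g (shift-mulT f) n) (⋆-distribʳ-⊕ g f (mulT (shift f)) n)) ⟩
  (f ⋆ g) n + (mulT (shift f) ⋆ g) n + (mulT f ⋆ shift g) n
    ≡⟨ cong₂ (λ a b → (f ⋆ g) n + a + b) (mulT-⋆ (shift f) g n) (mulT-⋆ f (shift g) n) ⟩
  (f ⋆ g) n + mulT (shift f ⋆ g) n + mulT (f ⋆ shift g) n
    ≡⟨ +-assoc ((f ⋆ g) n) _ _ ⟩
  (f ⋆ g) n + (mulT (shift f ⋆ g) n + mulT (f ⋆ shift g) n)
    ≡⟨ cong ((f ⋆ g) n +_) (trans (mulT-⊕ (shift f ⋆ g) (f ⋆ shift g) n) (mulT-shift (f ⋆ g) n)) ⟩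
  (f ⋆ g) n + ℕ→ℚ n * (f ⋆ g) n
    ≡⟨ sym (ℕ→ℚ-suc-* n ((f ⋆ g) n)) ⟩
  ℕ→ℚ (suc n) * (f ⋆ g) n
    ∎
  where open ≡-Reasoning

⋆-mulT : ∀ f g → f ⋆ mulT g ≗ mulT (f ⋆ g)
⋆-mulT f g n = begin
  (f ⋆ mulT g) n    ≡⟨ ⋆-comm f (mulT g) n ⟩
  (mulT g ⋆ f) n    ≡⟨ mulT-⋆ g f n ⟩
  mulT (g ⋆ f) n    ≡⟨ mulT-cong (⋆-comm g f) n ⟩
  mulT (f ⋆ g) n    ∎
  where open ≡-Reasoning

binomialSum : Seq → Seq → Seq
binomialSum f g n = sumBelow (suc n) (λ k → binom n k * f k * g (n ∸ k))

binomialSum-suc : ∀ f g n → binomialSum f g (suc n) ≡ binomialSum (shift f) g n + binomialSum f (shift g) n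
binomialSum-suc f g n = begin
  binomialSum f g (suc n)
    ≡⟨ sumBelow-suc-first (suc n) _ ⟩
  first + sumBelow (suc n) (λ i → binom (suc n) (suc i) * f (suc i) * g (n ∸ i))
    ≡⟨ cong (first +_) (trans (sumBelow-cong (suc n) pascal) (sumBelow-+ (suc n) _ _)) ⟩
  first + (binomialSum (shift f) g n + sumBelow (suc n) upper)
    ≡⟨ cong (λ q → first + (binomialSum (shift f) g n + q)) upper-reindex ⟩
  first + (binomialSum (shift f) g n + sumBelow n upper′)
    ≡⟨ solve 3 (λ a p q → a :+ (p :+ q) := p :+ (a :+ q)) refl first (binomialSum (shift f) g n) _ ⟩
  binomialSum (shift f) g n + (first + sumBelow n upper′)
    ≡⟨ cong (binomialSum (shift f) g n +_) (sym (sumBelow-suc-first n _)) ⟩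
  binomialSum (shift f) g n + binomialSum f (shift g) n
    ∎
  where
  open ≡-Reasoning
  first : ℚ
  first = binom (suc n) 0 * f 0 * g (suc n)
  upper upper′ : ℕ → ℚ
  upper  i = binom n (suc i) * f (suc i) * g (n ∸ i)
  upper′ i = binom n (suc i) * f (suc i) * g (suc (n ∸ suc i))

  pascal : ∀ i → binom (suc n) (suc i) * f (suc i) * g (n ∸ i)
               ≡ binom n i * f (suc i) * g (n ∸ i) + upper i
  pascal i = trans (cong (λ b → b * f (suc i) * g (n ∸ i)) (binom-pascal n i))
                   (solve 4 (λ a b c d → (a :+ b) :* c :* d := a :* c :* d :+ b :* c :* d) refl
                          (binom n i) (binom n (suc i)) (f (suc i)) (g (n ∸ i)))

  upper-reindex : sumBelow (suc n) upper ≡ sumBelow n upper′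
  upper-reindex = begin
    sumBelow n upper + binom n (suc n) * f (suc n) * g (n ∸ n)
      ≡⟨ cong (λ b → sumBelow n upper + b * f (suc n) * g (n ∸ n)) (binom[n,1+n]≡0 n) ⟩
    sumBelow n upper + 0ℚ * f (suc n) * g (n ∸ n)
      ≡⟨ cong (λ q → sumBelow n upper + q * g (n ∸ n)) (*-zeroˡ (f (suc n))) ⟩
    sumBelow n upper + 0ℚ * g (n ∸ n)
      ≡⟨ trans (cong (sumBelow n upper +_) (*-zeroˡ (g (n ∸ n)))) (+-identityʳ _) ⟩
    sumBelow n upper
      ≡⟨ sumBelow-cong-< n (λ {i} i<n → cong (λ j → binom n (suc i) * f (suc i) * g j) (ℕ.+-∸-assoc 1 i<n)) ⟩
    sumBelow n upper′
      ∎

⋆-binomialSum : ∀ f g → f ⋆ g ≗ binomialSum f g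
⋆-binomialSum f g zero    = sym (trans (+-identityˡ _) (cong (_* g 0) (*-identityˡ (f 0))))
⋆-binomialSum f g (suc n) = trans (cong₂ _+_ (⋆-binomialSum (shift f) g n) (⋆-binomialSum f (shift g) n))
                                  (sym (binomialSum-suc f g n))

⋆-expm1 : ∀ f n → (f ⋆ expm1) (suc n) ≡ sumBelow (suc n) (λ k → binom (suc n) k * f k)
⋆-expm1 f n = begin
  (f ⋆ expm1) (suc n)
    ≡⟨ ⋆-binomialSum f expm1 (suc n) ⟩
  sumBelow (suc n) term + binom (suc n) (suc n) * f (suc n) * expm1 (n ∸ n)
    ≡⟨ cong (λ j → sumBelow (suc n) term + binom (suc n) (suc n) * f (suc n) * expm1 j) (ℕ.n∸n≡0 n) ⟩
  sumBelow (suc n) term + binom (suc n) (suc n) * f (suc n) * 0ℚ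
    ≡⟨ trans (cong (sumBelow (suc n) term +_) (*-zeroʳ (binom (suc n) (suc n) * f (suc n)))) (+-identityʳ _) ⟩
  sumBelow (suc n) term
    ≡⟨ sumBelow-cong-< (suc n) (λ {k} k<1+n →
         trans (cong (λ j → binom (suc n) k * f k * expm1 j) (ℕ.+-∸-assoc 1 (ℕ.≤-pred k<1+n)))
               (*-identityʳ _)) ⟩
  sumBelow (suc n) (λ k → binom (suc n) k * f k)
    ∎
  where
  open ≡-Reasoning
  term : ℕ → ℚ
  term k = binom (suc n) k * f k * expm1 (suc n ∸ k)

expm1-⋆-exp : ∀ a → expm1 ⋆ exp a ≗ (λ n → (1ℚ + a) ^ n - a ^ n)
expm1-⋆-exp a zero    = refl
expm1-⋆-exp a (suc n) = begin
  (shift expm1 ⋆ exp a) n + (expm1 ⋆ a · exp a) n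
    ≡⟨ cong₂ _+_ (trans (⋆-congʳ (exp a) (sym ∘ ^-zeroˡ) n) (exp-⋆-exp 1ℚ a n))
                 (trans (⋆-·-comm a expm1 (exp a) n) (cong (a *_) (expm1-⋆-exp a n))) ⟩
  (1ℚ + a) ^ n + a * ((1ℚ + a) ^ n - a ^ n)
    ≡⟨ solve 3 (λ a b c → b :+ a :* (b :- c) := (con 1ℚ :+ a) :* b :- a :* c) refl a ((1ℚ + a) ^ n) (a ^ n) ⟩
  (1ℚ + a) ^ suc n - a ^ suc n
    ∎
  where open ≡-Reasoning

dilate-expm1 : ∀ m → dilate (ℕ→ℚ m) expm1 ≗ expm1 ⋆ powerSums m
dilate-expm1 m n = sym (begin
  (expm1 ⋆ powerSums m) n
    ≡⟨ ⋆-distribˡ-sumBelow m expm1 (exp ∘ ℕ→ℚ) n ⟩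
  sumBelow m (λ j → (expm1 ⋆ exp (ℕ→ℚ j)) n)
    ≡⟨ sumBelow-cong m (λ j → trans (expm1-⋆-exp (ℕ→ℚ j) n)
                                    (cong (λ u → u ^ n - ℕ→ℚ j ^ n) (sym (ℕ→ℚ-suc j)))) ⟩
  sumBelow m (λ j → ℕ→ℚ (suc j) ^ n - ℕ→ℚ j ^ n)
    ≡⟨ sumBelow-telescope m (λ j → ℕ→ℚ j ^ n) ⟩
  ℕ→ℚ m ^ n - 0ℚ ^ n
    ≡⟨ minus-0^ n ⟩
  ℕ→ℚ m ^ n * expm1 n
    ∎)
  where
  open ≡-Reasoning
  minus-0^ : ∀ n → ℕ→ℚ m ^ n - 0ℚ ^ n ≡ ℕ→ℚ m ^ n * expm1 n
  minus-0^ zero    = refl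
  minus-0^ (suc n) = begin
    ℕ→ℚ m ^ suc n - 0ℚ * 0ℚ ^ n  ≡⟨ cong (λ u → ℕ→ℚ m ^ suc n - u) (*-zeroˡ (0ℚ ^ n)) ⟩
    ℕ→ℚ m ^ suc n + 0ℚ           ≡⟨ +-identityʳ (ℕ→ℚ m ^ suc n) ⟩
    ℕ→ℚ m ^ suc n                ≡⟨ sym (*-identityʳ (ℕ→ℚ m ^ suc n)) ⟩
    ℕ→ℚ m ^ suc n * 1ℚ           ∎

exp-⋆-powerSums : ∀ a m → exp a ⋆ powerSums m ≗ (λ n → sumBelow m (λ j → (a + ℕ→ℚ j) ^ n))
exp-⋆-powerSums a m n = trans (⋆-distribˡ-sumBelow m (exp a) (exp ∘ ℕ→ℚ) n)
                              (sumBelow-cong m (λ j → exp-⋆-exp a (ℕ→ℚ j) n))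

bernoulli : ℚ → Seq
bernoulli x n = B n x

geometric : ℚ → Seq
geometric y n = w n y

bernTable-B : ∀ x {n k} → k < n → bernTable n x k ≡ B k x
bernTable-B x {suc n} = upd-table (upd-same n _ (bernTable n x)) (bernTable-B x {n})

B-recurrence : ∀ n x → B n x ≡ x ^ n - recip (ℕ→ℚ (suc n)) * sumBelow n (λ k → binom (suc n) k * B k x)
B-recurrence n x = trans (upd-same n _ (bernTable n x))
  (cong (λ s → x ^ n - recip (ℕ→ℚ (suc n)) * s)
        (sumBelow-cong-< n (λ {k} k<n → cong (binom (suc n) k *_) (bernTable-B x k<n))))

sumBelow-binom-B : ∀ n x → sumBelow (suc n) (λ k → binom (suc n) k * B k x) ≡ ℕ→ℚ (suc n) * x ^ n
sumBelow-binom-B n x = begin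
  S + binom (suc n) n * B n x
    ≡⟨ cong₂ (λ c b → S + c * b) (binom[1+n,n]≡1+n n) (B-recurrence n x) ⟩
  S + N * (x ^ n - recip N * S)
    ≡⟨ solve 4 (λ S N X r → S :+ N :* (X :- r :* S) := N :* X :+ (con 1ℚ :- r :* N) :* S) refl S N (x ^ n) (recip N) ⟩
  N * x ^ n + (1ℚ - recip N * N) * S
    ≡⟨ cong (λ u → N * x ^ n + (1ℚ - u) * S) (recip-inverseˡ (ℕ→ℚ-suc≢0 n)) ⟩
  N * x ^ n + 0ℚ * S
    ≡⟨ trans (cong (N * x ^ n +_) (*-zeroˡ S)) (+-identityʳ _) ⟩
  N * x ^ n
    ∎
  where
  open ≡-Reasoning
  N S : ℚ
  N = ℕ→ℚ (suc n)
  S = sumBelow n (λ k → binom (suc n) k * B k x)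

bernoulli-⋆-expm1 : ∀ x → bernoulli x ⋆ expm1 ≗ mulT (exp x)
bernoulli-⋆-expm1 x zero    = *-zeroʳ (B 0 x)
bernoulli-⋆-expm1 x (suc n) = trans (⋆-expm1 (bernoulli x) n) (sumBelow-binom-B n x)

geomTable-w : ∀ y {n k} → k < n → geomTable n y k ≡ w k y
geomTable-w y {suc zero}    {zero}  _        = refl
geomTable-w y {suc zero}    {suc k} (s≤s ())
geomTable-w y {suc (suc n)}                  = upd-table (upd-same (suc n) _ (geomTable (suc n) y)) (geomTable-w y {suc n})

w-recurrence : ∀ n y → w (suc n) y ≡ y * sumBelow (suc n) (λ k → binom (suc n) k * w k y)
w-recurrence n y = trans (upd-same (suc n) _ (geomTable (suc n) y))
  (cong (y *_) (sumBelow-cong-< (suc n) (λ {k} k<1+n → cong (binom (suc n) k *_) (geomTable-w y k<1+n))))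

dropConst-geometric : ∀ y → dropConst (geometric y) ≗ y · (geometric y ⋆ expm1)
dropConst-geometric y zero    = sym (trans (cong (y *_) (*-zeroʳ (w 0 y))) (*-zeroʳ y))
dropConst-geometric y (suc n) = trans (w-recurrence n y) (cong (y *_) (sym (⋆-expm1 (geometric y) n)))

dropConst-⋆ : ∀ f g n →
              (dropConst f ⋆ g) (suc n) ≡ sumBelow (suc n) (λ i → binom (suc n) (suc i) * f (suc i) * g (n ∸ i))
dropConst-⋆ f g n = begin
  (dropConst f ⋆ g) (suc n)
    ≡⟨ ⋆-binomialSum (dropConst f) g (suc n) ⟩
  binomialSum (dropConst f) g (suc n)
    ≡⟨ sumBelow-suc-first (suc n) _ ⟩
  binom (suc n) 0 * 0ℚ * g (suc n) + S
    ≡⟨ cong (_+ S) (trans (cong (_* g (suc n)) (*-zeroʳ (binom (suc n) 0))) (*-zeroˡ (g (suc n)))) ⟩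
  0ℚ + S
    ≡⟨ +-identityˡ S ⟩
  S ∎
  where
  open ≡-Reasoning
  S : ℚ
  S = sumBelow (suc n) (λ i → binom (suc n) (suc i) * f (suc i) * g (n ∸ i))

dilate-w₂ : ∀ c a y n → c ^ n * w₂ n a y ≡ (dilate c (geometric y) ⋆ exp (c * a)) n
dilate-w₂ c a y n = begin
  c ^ n * w₂ n a y                               ≡⟨ cong (c ^ n *_) (⋆-binomialSum (geometric y) (exp a) n) ⟨
  dilate c (geometric y ⋆ exp a) n               ≡⟨ dilate-⋆ c (geometric y) (exp a) n ⟩
  (dilate c (geometric y) ⋆ dilate c (exp a)) n  ≡⟨ ⋆-congˡ (dilate c (geometric y)) (dilate-exp c a) n ⟩
  (dilate c (geometric y) ⋆ exp (c * a)) n       ∎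
  where open ≡-Reasoning

expm1-⋆-powerSums-⋆-bernoulli : ∀ m z → expm1 ⋆ powerSums m ⋆ bernoulli z ≗ mulT (exp z ⋆ powerSums m)
expm1-⋆-powerSums-⋆-bernoulli m z = begin
  expm1 ⋆ G ⋆ bernoulli z      ≈⟨ ⋆-congʳ (bernoulli z) (⋆-comm expm1 G) ⟩
  G ⋆ expm1 ⋆ bernoulli z      ≈⟨ ⋆-assoc G expm1 (bernoulli z) ⟩
  G ⋆ (expm1 ⋆ bernoulli z)    ≈⟨ ⋆-congˡ G (⋆-comm expm1 (bernoulli z)) ⟩
  G ⋆ (bernoulli z ⋆ expm1)    ≈⟨ ⋆-congˡ G (bernoulli-⋆-expm1 z) ⟩
  G ⋆ mulT (exp z)             ≈⟨ ⋆-mulT G (exp z) ⟩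
  mulT (G ⋆ exp z)             ≈⟨ mulT-cong (⋆-comm G (exp z)) ⟩
  mulT (exp z ⋆ G)             ∎
  where
  open ≗-Reasoning
  G : Seq
  G = powerSums m

module MultiplicationFormula (m : ℕ) (x y : ℚ) where

  M z : ℚ
  M = ℕ→ℚ m
  z = M * x

  V G : Seq
  V = dilate M (geometric y)
  G = powerSums m

  M^p*sum-w₂ : M ≢ 0ℚ → ∀ p →
               M ^ p * sumBelow m (λ j → w₂ p (x + ℕ→ℚ j * recip M) y) ≡ (V ⋆ (exp z ⋆ G)) p
  M^p*sum-w₂ M≢0 p = begin
    M ^ p * sumBelow m (λ j → w₂ p (x + ℕ→ℚ j * recip M) y)
      ≡⟨ sumBelow-*ˡ m (M ^ p) _ ⟨
    sumBelow m (λ j → M ^ p * w₂ p (x + ℕ→ℚ j * recip M) y)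
      ≡⟨ sumBelow-cong m (λ j → dilate-w₂ M (x + ℕ→ℚ j * recip M) y p) ⟩
    sumBelow m (λ j → (V ⋆ exp (M * (x + ℕ→ℚ j * recip M))) p)
      ≡⟨ sumBelow-cong m (λ j → cong (λ a → (V ⋆ exp a) p) (node j)) ⟩
    sumBelow m (λ j → (V ⋆ exp (z + ℕ→ℚ j)) p)
      ≡⟨ ⋆-distribˡ-sumBelow m V (λ j → exp (z + ℕ→ℚ j)) p ⟨
    (V ⋆ (λ k → sumBelow m (λ j → (z + ℕ→ℚ j) ^ k))) p
      ≡⟨ ⋆-congˡ V (exp-⋆-powerSums z m) p ⟨
    (V ⋆ (exp z ⋆ G)) p
      ∎
    where
    open ≡-Reasoning
    node : ∀ j → M * (x + ℕ→ℚ j * recip M) ≡ z + ℕ→ℚ j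
    node j = begin
      M * (x + ℕ→ℚ j * recip M)
        ≡⟨ solve 4 (λ M x j r → M :* (x :+ j :* r) := M :* x :+ j :* (r :* M)) refl M x (ℕ→ℚ j) (recip M) ⟩
      z + ℕ→ℚ j * (recip M * M)
        ≡⟨ cong (λ u → z + ℕ→ℚ j * u) (recip-inverseˡ M≢0) ⟩
      z + ℕ→ℚ j * 1ℚ
        ≡⟨ cong (z +_) (*-identityʳ (ℕ→ℚ j)) ⟩
      z + ℕ→ℚ j
        ∎

  dropConst-V : dropConst V ≗ y · (V ⋆ (expm1 ⋆ G))
  dropConst-V = begin
    dropConst V                           ≈⟨ dilate-dropConst M (geometric y) ⟨
    dilate M (dropConst (geometric y))    ≈⟨ dilate-cong M (dropConst-geometric y) ⟩
    dilate M (y · (geometric y ⋆ expm1))  ≈⟨ dilate-· M y (geometric y ⋆ expm1) ⟩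
    y · dilate M (geometric y ⋆ expm1)    ≈⟨ ·-congˡ y (dilate-⋆ M (geometric y) expm1) ⟩
    y · (V ⋆ dilate M expm1)              ≈⟨ ·-congˡ y (⋆-congˡ V (dilate-expm1 m)) ⟩
    y · (V ⋆ (expm1 ⋆ G))                 ∎
    where open ≗-Reasoning

  dropConst-V-⋆-bernoulli : dropConst V ⋆ bernoulli z ≗ y · mulT (V ⋆ (exp z ⋆ G))
  dropConst-V-⋆-bernoulli = begin
    dropConst V ⋆ bernoulli z               ≈⟨ ⋆-congʳ (bernoulli z) dropConst-V ⟩
    y · (V ⋆ (expm1 ⋆ G)) ⋆ bernoulli z     ≈⟨ ·-⋆-assoc y (V ⋆ (expm1 ⋆ G)) (bernoulli z) ⟩
    y · (V ⋆ (expm1 ⋆ G) ⋆ bernoulli z)     ≈⟨ ·-congˡ y (⋆-assoc V (expm1 ⋆ G) (bernoulli z)) ⟩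
    y · (V ⋆ (expm1 ⋆ G ⋆ bernoulli z))     ≈⟨ ·-congˡ y (⋆-congˡ V (expm1-⋆-powerSums-⋆-bernoulli m z)) ⟩
    y · (V ⋆ mulT (exp z ⋆ G))              ≈⟨ ·-congˡ y (⋆-mulT V (exp z ⋆ G)) ⟩
    y · mulT (V ⋆ (exp z ⋆ G))              ∎
    where open ≗-Reasoning

  sum-binom-B-w : ∀ p → sumBelow (suc p) (λ i → binom (suc p) (suc i) * M ^ suc i * B (p ∸ i) z * w (suc i) y)
                      ≡ (dropConst V ⋆ bernoulli z) (suc p)
  sum-binom-B-w p = trans (sumBelow-cong (suc p) reorder) (sym (dropConst-⋆ V (bernoulli z) p))
    where
    reorder : ∀ i → binom (suc p) (suc i) * M ^ suc i * B (p ∸ i) z * w (suc i) y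
                  ≡ binom (suc p) (suc i) * V (suc i) * B (p ∸ i) z
    reorder i = solve 4 (λ c m b w → c :* m :* b :* w := c :* (m :* w) :* b) refl
                        (binom (suc p) (suc i)) (M ^ suc i) (B (p ∸ i) z) (w (suc i) y)

proposition4 : (m n : ℕ) → 1 ≤ m → 1 ≤ n → (x y : ℚ) → y ≢ 0ℚ →
    (ℕ→ℚ m ^ (n ∸ 1)) * sumFromTo 0 (m ∸ 1) (λ k → w₂ (n ∸ 1) (x + ℕ→ℚ k * recip (ℕ→ℚ m)) y)
      ≡ recip (ℕ→ℚ n * y) * sumFromTo 1 n (λ k → binom n k * (ℕ→ℚ m ^ k) * B (n ∸ k) (ℕ→ℚ m * x) * w k y)
proposition4 (suc m′) (suc p) _ _ x y y≢0 = begin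
  M ^ p * sumBelow (suc m′) (λ j → w₂ p (x + ℕ→ℚ j * recip M) y)
    ≡⟨ M^p*sum-w₂ (ℕ→ℚ-suc≢0 m′) p ⟩
  L
    ≡⟨ recip-*-cancelˡ (*-≢0 (ℕ→ℚ-suc≢0 p) y≢0) L ⟨
  recip (N * y) * (N * y * L)
    ≡⟨ cong (recip (N * y) *_) (solve 3 (λ n y l → n :* y :* l := y :* (n :* l)) refl N y L) ⟩
  recip (N * y) * (y * (N * L))
    ≡⟨ cong (recip (N * y) *_) (dropConst-V-⋆-bernoulli (suc p)) ⟨
  recip (N * y) * (dropConst V ⋆ bernoulli z) (suc p)
    ≡⟨ cong (recip (N * y) *_) (sum-binom-B-w p) ⟨
  recip (N * y) * sumBelow (suc p) (λ i → binom (suc p) (suc i) * M ^ suc i * B (p ∸ i) z * w (suc i) y)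
    ∎
  where
  open MultiplicationFormula (suc m′) x y
  open ≡-Reasoning
  N L : ℚ
  N = ℕ→ℚ (suc p)
  L = (V ⋆ (exp z ⋆ G)) p
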